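{- Let $G=(V,E)$ be a threshold graph. An edge $e\in E$ satisfies that $G-e$ is a threshold graph if and only if $e$ is neither the middle edge of an induced diamond nor a side edge of an induced paw in $G$.
   Context: A graph $G=(V,E)$ is threshold if there exist $\ell:V\to\mathbb{N}_0$ and $t\in\mathbb{N}_0$ such that $X\subseteq V$ is independent iff $\sum_{x\in X}\ell(x)\le t$ (equivalently, $G$ has no induced $2K_2$, $P_4$ or $C_4$). A diamond is $K_4$ minus an edge; its middle edge joins its two degree-three vertices. A paw is the graph on $\{a,b,c,d\}$ with edges $ab,bc,cd,bd$; its side edges are $bc$ and $bd$. -}

module Defs where

open import Data.Nat using (ℕ; zero; suc; _+_; _≤_)
open import Data.Fin using (Fin; zero; suc; _≟_)
open import Data.Bool using (Bool; true; false; if_then_else_; _∧_; _∨_; not)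
open import Data.Product using (Σ; _×_; ∃; ∃-syntax)
open import Data.Sum using (_⊎_)
open import Relation.Nullary using (¬_)
open import Relation.Nullary.Decidable using (⌊_⌋)
open import Relation.Binary.PropositionalEquality using (_≡_)
open import Function.Bundles using (_⇔_)

record Graph (n : ℕ) : Set where
  field
    adj   : Fin n → Fin n → Bool
    sym   : ∀ x y → adj x y ≡ adj y x
    irrefl : ∀ x → adj x x ≡ false

open Graph public

Adj : ∀ {n} → Graph n → Fin n → Fin n → Set
Adj G x y = adj G x y ≡ true

VSubset : ℕ → Set
VSubset n = Fin n → Bool

Independent : ∀ {n} → Graph n → VSubset n → Set
Independent G X = ∀ x y → X x ≡ true → X y ≡ true → ¬ Adj G x y

weightSum : ∀ {n} → (Fin n → ℕ) → VSubset n → ℕ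
weightSum {zero}  ℓ X = 0
weightSum {suc n} ℓ X =
  (if X zero then ℓ zero else 0) + weightSum (λ i → ℓ (suc i)) (λ i → X (suc i))

Threshold : ∀ {n} → Graph n → Set
Threshold {n} G =
  Σ (Fin n → ℕ) λ ℓ → Σ ℕ λ t →
    (X : VSubset n) → Independent G X ⇔ (weightSum ℓ X ≤ t)

samePair : ∀ {n} → Fin n → Fin n → Fin n → Fin n → Bool
samePair u v x y =
  (⌊ x ≟ u ⌋ ∧ ⌊ y ≟ v ⌋) ∨ (⌊ x ≟ v ⌋ ∧ ⌊ y ≟ u ⌋)

deleteEdge : ∀ {n} → Graph n → Fin n → Fin n → Graph n
deleteEdge G u v = record
  { adj = λ x y → adj G x y ∧ not (samePair u v x y)
  ; sym = sym′
  ; irrefl = λ x → irr′ x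
  }
  where
  open import Relation.Binary.PropositionalEquality using (refl; cong₂; cong)
  open import Data.Bool.Properties using (∨-comm)
  sp-sym : ∀ x y → samePair u v x y ≡ samePair u v y x
  sp-sym x y with x ≟ u | y ≟ v | x ≟ v | y ≟ u
  ... | a | b | c | d = helper ⌊ a ⌋ ⌊ b ⌋ ⌊ c ⌋ ⌊ d ⌋
    where
    open import Data.Bool.Properties using (∧-comm)
    helper : ∀ p q r s → (p ∧ q) ∨ (r ∧ s) ≡ (s ∧ r) ∨ (q ∧ p)
    helper false false false false = refl
    helper false false false true = refl
    helper false false true false = refl
    helper false false true true = refl
    helper false true false false = refl
    helper false true false true = refl
    helper false true true false = refl
    helper false true true true = refl
    helper true false false false = refl
    helper true false false true = refl
    helper true false true false = refl
    helper true false true true = refl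
    helper true true false false = refl
    helper true true false true = refl
    helper true true true false = refl
    helper true true true true = refl
  sym′ : ∀ x y → (adj G x y ∧ not (samePair u v x y)) ≡ (adj G y x ∧ not (samePair u v y x))
  sym′ x y = cong₂ _∧_ (Graph.sym G x y) (cong not (sp-sym x y))
  irr′ : ∀ x → (adj G x x ∧ not (samePair u v x x)) ≡ false
  irr′ x with adj G x x | Graph.irrefl G x
  ... | false | _ = refl

MiddleOfDiamond : ∀ {n} → Graph n → Fin n → Fin n → Set
MiddleOfDiamond G u v = ∃[ a ] ∃[ b ]
  ( ¬ u ≡ v × ¬ u ≡ a × ¬ u ≡ b × ¬ v ≡ a × ¬ v ≡ b × ¬ a ≡ b
  × Adj G u v × Adj G u a × Adj G u b × Adj G v a × Adj G v b
  × ¬ Adj G a b )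

PawSideEdge : ∀ {n} → Graph n → Fin n → Fin n → Set
PawSideEdge G b c = ∃[ a ] ∃[ d ]
  ( ¬ a ≡ b × ¬ a ≡ c × ¬ a ≡ d × ¬ b ≡ c × ¬ b ≡ d × ¬ c ≡ d
  × Adj G a b × Adj G b c × Adj G c d × Adj G b d
  × ¬ Adj G a c × ¬ Adj G a d )

SideOfPaw : ∀ {n} → Graph n → Fin n → Fin n → Set
SideOfPaw G u v = PawSideEdge G u v ⊎ PawSideEdge G v u

{-# OPTIONS --safe #-}
module Submission where

-- A threshold graph has no alternating 4-cycle x a y b (edges xa, yb; non-edges xb, ya): the two
-- non-edges weigh at most t each and the two edges more than t each, yet both pairs of pairs have the
-- same total weight. Conversely, without alternating 4-cycles the neighbourhoods are totally preordered
-- by inclusion, so every nonempty vertex set S contains a vertex w that is isolated or dominating in S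
-- (a maximum, or a non-neighbour of a maximum). Weights for S - w, doubled, extend to S by giving w
-- weight 1 or 2t + 1, with new threshold 2t + 1.
--
-- Deleting uv from an alternating-free graph creates an alternating 4-cycle only with uv as one of its
-- non-edges. The other non-edge is then a non-edge of G as well, so the cycle contains a path a x b y
-- with {x, b} = {u, v} and a, y non-adjacent; the chords xy and ab decide whether xb is the middle edge
-- of a diamond or a side edge of a paw (with neither chord, a x y b is an alternating 4-cycle in G).
-- Conversely a diamond or paw on uv supplies such a path, which becomes alternating once uv is deleted.

open import Defs
open import Data.Bool as Bool using (true; false; if_then_else_; _∧_; _∨_; not)
open import Data.Bool.Properties using (∧-conicalˡ; ∧-conicalʳ)
open import Data.Empty using (⊥-elim)
open import Data.Fin using (Fin; zero; suc; _≟_)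
open import Data.Fin.Properties using (any?)
open import Data.List using (List; []; _∷_; allFin)
open import Data.List.Membership.Propositional.Properties using (∈-allFin)
open import Data.List.Relation.Unary.All as All using (All; []; _∷_)
open import Data.Nat using (ℕ; zero; suc; _+_; _*_; _≤_; _<_; z≤n; s≤s)
open import Data.Nat.Properties
  using ( +-comm; +-assoc; *-zeroʳ; *-distribˡ-+; *-suc; suc-injective
        ; ≤-refl; ≤-reflexive; ≤-trans; ≤-pred; <⇒≱; ≰⇒>; m≤m+n; m≤n+m
        ; +-mono-≤; +-mono-<; *-monoʳ-≤; *-cancelˡ-<; +-commutativeSemigroup )
open import Algebra.Properties.CommutativeSemigroup +-commutativeSemigroup using (interchange)
open import Data.Product using (_×_; _,_; ∃-syntax)
open import Data.Sum as Sum using (_⊎_; inj₁; inj₂; [_,_])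
open import Data.Vec.Functional using (updateAt)
open import Data.Vec.Functional.Properties using (updateAt-updates; updateAt-minimal; updateAt-id-local)
open import Function using (_∘_; const; id)
open import Function.Bundles using (_⇔_; mk⇔; Equivalence)
open import Function.Construct.Composition using (_⇔-∘_)
open import Function.Construct.Symmetry using (⇔-sym)
open import Relation.Nullary using (¬_; Dec; yes; no; contradiction)
open import Relation.Nullary.Decidable
  using (⌊_⌋; does; ¬?; _×-dec_; _⊎-dec_; decidable-stable; isYes≗does; dec-true; dec-false)
open import Relation.Unary using (Decidable)
open import Relation.Binary.PropositionalEquality as ≡
  using (_≡_; _≢_; refl; cong; cong₂; subst; trans)
open ≡.≡-Reasoning

private
  variable
    n : ℕ

infix  4 _∈_ _⊆_
infixl 6 _─_

_∈_ : Fin n → VSubset n → Set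
i ∈ X = X i ≡ true

_⊆_ : VSubset n → VSubset n → Set
X ⊆ Y = ∀ {i} → i ∈ X → i ∈ Y

Empty : VSubset n → Set
Empty X = ∀ i → ¬ i ∈ X

nonempty? : (X : VSubset n) → Dec (∃[ i ] i ∈ X)
nonempty? X = any? (λ i → X i Bool.≟ true)

-- X ─ w and ⁅ p , q ⁆ are opaque so that a membership proof i ∈ X ─ w or i ∈ ⁅ p , q ⁆
-- still determines the set during unification.
opaque
  _─_ : VSubset n → Fin n → VSubset n
  X ─ w = updateAt X w (const false)

  ⁅_,_⁆ : Fin n → Fin n → VSubset n
  ⁅ p , q ⁆ i = ⌊ i ≟ p ⌋ ∨ ⌊ i ≟ q ⌋

opaque
  unfolding _─_

  w∉X─w : ∀ {X : VSubset n} {w} → ¬ w ∈ X ─ w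
  w∉X─w {X = X} {w} w∈X─w = contradiction (trans (≡.sym (updateAt-updates w X)) w∈X─w) λ ()

  ∈-─⇒≢ : ∀ {X : VSubset n} {w i} → i ∈ X ─ w → i ≢ w
  ∈-─⇒≢ {X = X} i∈X─w refl = w∉X─w {X = X} i∈X─w

  ∈-─ : ∀ {X : VSubset n} {w i} → i ≢ w → i ∈ X → i ∈ X ─ w
  ∈-─ {X = X} {w} {i} i≢w = trans (updateAt-minimal i w X i≢w)

  ─-⊆ : ∀ {X : VSubset n} {w} → X ─ w ⊆ X
  ─-⊆ {X = X} {w} {i} i∈X─w = trans (≡.sym (updateAt-minimal i w X (∈-─⇒≢ i∈X─w))) i∈X─w

  weightSum-updateAt : ∀ (ℓ : Fin n → ℕ) X w a →
    weightSum (updateAt ℓ w (const a)) X ≡ weightSum ℓ (X ─ w) + (if X w then a else 0)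
  weightSum-updateAt {suc n} ℓ X zero    a = +-comm (if X zero then a else 0) _
  weightSum-updateAt {suc n} ℓ X (suc w) a =
    trans (cong ((if X zero then ℓ zero else 0) +_) (weightSum-updateAt (ℓ ∘ suc) (X ∘ suc) w a))
          (≡.sym (+-assoc (if X zero then ℓ zero else 0) _ _))

opaque
  unfolding ⁅_,_⁆

  ∈-pairˡ : ∀ (p q : Fin n) → p ∈ ⁅ p , q ⁆
  ∈-pairˡ p q with p ≟ p
  ... | yes _   = refl
  ... | no p≢p = contradiction refl p≢p

  ∈-pairʳ : ∀ (p q : Fin n) → q ∈ ⁅ p , q ⁆
  ∈-pairʳ p q with q ≟ p | q ≟ q
  ... | yes _ | _      = refl
  ... | no _  | yes _  = refl
  ... | no _  | no q≢q = contradiction refl q≢q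

  ∈-pair⁻ : ∀ {i} (p q : Fin n) → i ∈ ⁅ p , q ⁆ → i ≡ p ⊎ i ≡ q
  ∈-pair⁻ {i = i} p q i∈pq with i ≟ p | i ≟ q
  ... | yes i≡p | _       = inj₁ i≡p
  ... | no _    | yes i≡q = inj₂ i≡q
  ... | no _    | no _    = contradiction i∈pq λ ()

─-mono : ∀ {X Y : VSubset n} {w} → X ⊆ Y → X ─ w ⊆ Y ─ w
─-mono X⊆Y i∈X─w = ∈-─ (∈-─⇒≢ i∈X─w) (X⊆Y (─-⊆ i∈X─w))

weightSum-cong : ∀ {ℓ ℓ′ : Fin n → ℕ} → (∀ i → ℓ i ≡ ℓ′ i) → ∀ X → weightSum ℓ X ≡ weightSum ℓ′ X
weightSum-cong {zero}  ℓ≗ℓ′ X = refl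
weightSum-cong {suc n} ℓ≗ℓ′ X =
  cong₂ _+_ (cong (λ c → if X zero then c else 0) (ℓ≗ℓ′ zero)) (weightSum-cong (ℓ≗ℓ′ ∘ suc) (X ∘ suc))

weightSum-─ : ∀ (ℓ : Fin n → ℕ) X {w} → w ∈ X → weightSum ℓ X ≡ weightSum ℓ (X ─ w) + ℓ w
weightSum-─ ℓ X {w} w∈X = begin
  weightSum ℓ X
    ≡⟨ weightSum-cong (≡.sym ∘ updateAt-id-local w ℓ refl) X ⟩
  weightSum (updateAt ℓ w (const (ℓ w))) X
    ≡⟨ weightSum-updateAt ℓ X w (ℓ w) ⟩
  weightSum ℓ (X ─ w) + (if X w then ℓ w else 0)
    ≡⟨ cong (λ b → weightSum ℓ (X ─ w) + (if b then ℓ w else 0)) w∈X ⟩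
  weightSum ℓ (X ─ w) + ℓ w
    ∎

weightSum-* : ∀ k (ℓ : Fin n → ℕ) X → weightSum (λ i → k * ℓ i) X ≡ k * weightSum ℓ X
weightSum-* {zero}  k ℓ X = ≡.sym (*-zeroʳ k)
weightSum-* {suc n} k ℓ X with X zero
... | true  = trans (cong (k * ℓ zero +_) (weightSum-* k (ℓ ∘ suc) (X ∘ suc)))
                    (≡.sym (*-distribˡ-+ k (ℓ zero) _))
... | false = weightSum-* k (ℓ ∘ suc) (X ∘ suc)

weightSum-empty : ∀ {ℓ : Fin n → ℕ} {X} → Empty X → weightSum ℓ X ≡ 0
weightSum-empty {zero}          empty = refl
weightSum-empty {suc n} {X = X} empty with X zero in X0≡
... | true  = contradiction X0≡ (empty zero)
... | false = weightSum-empty {X = X ∘ suc} (empty ∘ suc)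

∈⇒≤weightSum : ∀ (ℓ : Fin n → ℕ) X {i} → i ∈ X → ℓ i ≤ weightSum ℓ X
∈⇒≤weightSum ℓ X {zero}  i∈X rewrite i∈X = m≤m+n (ℓ zero) _
∈⇒≤weightSum ℓ X {suc i} i∈X =
  ≤-trans (∈⇒≤weightSum (ℓ ∘ suc) (X ∘ suc) i∈X) (m≤n+m _ (if X zero then ℓ zero else 0))

weightSum≡0⇔Empty : ∀ {ℓ : Fin n → ℕ} {X} → (∀ i → 0 < ℓ i) → weightSum ℓ X ≡ 0 ⇔ Empty X
weightSum≡0⇔Empty {ℓ = ℓ} {X} ℓ-pos = mk⇔
  (λ sum≡0 i i∈X → <⇒≱ (ℓ-pos i) (subst (ℓ i ≤_) sum≡0 (∈⇒≤weightSum ℓ X i∈X)))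
  weightSum-empty

weightSum-pair : ∀ (ℓ : Fin n → ℕ) {p q} → p ≢ q → weightSum ℓ ⁅ p , q ⁆ ≡ ℓ p + ℓ q
weightSum-pair ℓ {p} {q} p≢q = begin
  weightSum ℓ ⁅ p , q ⁆                        ≡⟨ weightSum-─ ℓ _ (∈-pairʳ p q) ⟩
  weightSum ℓ (⁅ p , q ⁆ ─ q) + ℓ q            ≡⟨ cong (_+ ℓ q) (weightSum-─ ℓ _ (∈-─ p≢q (∈-pairˡ p q))) ⟩
  weightSum ℓ (⁅ p , q ⁆ ─ q ─ p) + ℓ p + ℓ q  ≡⟨ cong (λ s → s + ℓ p + ℓ q) (weightSum-empty empty) ⟩
  ℓ p + ℓ q                                    ∎
  where
  empty : Empty (⁅ p , q ⁆ ─ q ─ p)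
  empty i i∈ with ∈-pair⁻ p q (─-⊆ (─-⊆ i∈))
  ... | inj₁ refl = ∈-─⇒≢ i∈ refl
  ... | inj₂ refl = ∈-─⇒≢ (─-⊆ i∈) refl

∣_∣ : VSubset n → ℕ
∣ X ∣ = weightSum (const 1) X

∣─∣ : ∀ (X : VSubset n) {w} → w ∈ X → ∣ X ∣ ≡ suc ∣ X ─ w ∣
∣─∣ X w∈X = trans (weightSum-─ (const 1) X w∈X) (+-comm _ 1)

2*m+b≤1+2*n⇔m≤n : ∀ m n {b} → b ≤ 1 → 2 * m + b ≤ suc (2 * n) ⇔ m ≤ n
2*m+b≤1+2*n⇔m≤n m n {b} b≤1 = mk⇔
  (λ le → ≤-pred (*-cancelˡ-< 2 m (suc n)
             (subst (2 * m <_) (≡.sym (*-suc 2 n)) (s≤s (≤-trans (m≤m+n (2 * m) b) le)))))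
  (λ m≤n → subst (2 * m + b ≤_) (+-comm (2 * n) 1) (+-mono-≤ (*-monoʳ-≤ 2 m≤n) b≤1))

2*m+n≤n⇔m≡0 : ∀ m n → 2 * m + n ≤ n ⇔ m ≡ 0
2*m+n≤n⇔m≡0 zero    n = mk⇔ (λ _ → refl) (λ _ → ≤-refl)
2*m+n≤n⇔m≡0 (suc m) n = mk⇔ (λ le → contradiction le (<⇒≱ (s≤s (m≤n+m n _)))) λ ()

Adj-sym : ∀ (G : Graph n) {x y} → Adj G x y → Adj G y x
Adj-sym G {x} {y} = trans (Graph.sym G y x)

Adj⇒≢ : ∀ (G : Graph n) {x y} → Adj G x y → x ≢ y
Adj⇒≢ G {x} x~x refl = contradiction (trans (≡.sym x~x) (Graph.irrefl G x)) λ ()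

adj? : ∀ (G : Graph n) x y → Dec (Adj G x y)
adj? G x y = adj G x y Bool.≟ true

Isolated : Graph n → VSubset n → Fin n → Set
Isolated G S w = ∀ {z} → z ∈ S → ¬ Adj G w z

Dominating : Graph n → VSubset n → Fin n → Set
Dominating G S w = ∀ {z} → z ∈ S → z ≢ w → Adj G w z

Independent-⊆ : ∀ (G : Graph n) {X Y} → Y ⊆ X → Independent G X → Independent G Y
Independent-⊆ G Y⊆X ind x y x∈Y y∈Y = ind x y (Y⊆X x∈Y) (Y⊆X y∈Y)

Independent-pair⇔ : ∀ (G : Graph n) {p q} → Independent G ⁅ p , q ⁆ ⇔ (¬ Adj G p q)
Independent-pair⇔ G {p} {q} = mk⇔ (λ ind → ind p q (∈-pairˡ p q) (∈-pairʳ p q)) independent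
  where
  independent : ¬ Adj G p q → Independent G ⁅ p , q ⁆
  independent p≁q x y x∈ y∈ x~y with ∈-pair⁻ p q x∈ | ∈-pair⁻ p q y∈
  ... | inj₁ refl | inj₁ refl = Adj⇒≢ G x~y refl
  ... | inj₁ refl | inj₂ refl = p≁q x~y
  ... | inj₂ refl | inj₁ refl = p≁q (Adj-sym G x~y)
  ... | inj₂ refl | inj₂ refl = Adj⇒≢ G x~y refl

Independent⇔Independent-─ : ∀ (G : Graph n) {X w} → (w ∈ X → Isolated G X w) →
                            Independent G X ⇔ Independent G (X ─ w)
Independent⇔Independent-─ G {X} {w} isolated = mk⇔ (Independent-⊆ G ─-⊆) independent
  where
  independent : Independent G (X ─ w) → Independent G X
  independent ind x y x∈X y∈X x~y with x ≟ w | y ≟ w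
  ... | yes refl | _        = isolated x∈X y∈X x~y
  ... | no _     | yes refl = isolated y∈X x∈X (Adj-sym G x~y)
  ... | no x≢w   | no y≢w   = ind x y (∈-─ x≢w x∈X) (∈-─ y≢w y∈X) x~y

Independent⇔Empty-─ : ∀ (G : Graph n) {X w} → w ∈ X → Dominating G X w →
                       Independent G X ⇔ Empty (X ─ w)
Independent⇔Empty-─ G {X} {w} w∈X dominating = mk⇔
  (λ ind y y∈X─w → ind w y w∈X (─-⊆ y∈X─w) (dominating (─-⊆ y∈X─w) (∈-─⇒≢ y∈X─w)))
  (λ empty x y x∈X y∈X x~y → Adj⇒≢ G x~y (trans (≡w empty x∈X) (≡.sym (≡w empty y∈X))))
  where
  ≡w : Empty (X ─ w) → ∀ {x} → x ∈ X → x ≡ w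
  ≡w empty {x} x∈X = decidable-stable (x ≟ w) λ x≢w → empty x (∈-─ x≢w x∈X)

-- An induced 2K₂, P₄ or C₄ is exactly an alternating 4-cycle, according to which of xy and ab are edges.
record Alternating (G : Graph n) (x a y b : Fin n) : Set where
  constructor alternating
  field
    x≢b : x ≢ b
    y≢a : y ≢ a
    x~a : Adj G x a
    y~b : Adj G y b
    x≁b : ¬ Adj G x b
    y≁a : ¬ Adj G y a

AlternatingFree : Graph n → Set
AlternatingFree G = ∀ {x a y b} → ¬ Alternating G x a y b

threshold⇒alternatingFree : ∀ {G : Graph n} → Threshold G → AlternatingFree G
threshold⇒alternatingFree {G = G} (ℓ , t , independent⇔) (alternating x≢b y≢a x~a y~b x≁b y≁a) =
  <⇒≱ (+-mono-< (heavy x~a) (heavy (Adj-sym G y~b)))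
      (subst (_≤ t + t) (interchange (ℓ _) (ℓ _) (ℓ _) (ℓ _))
             (+-mono-≤ (light x≢b x≁b) (light (y≢a ∘ ≡.sym) (y≁a ∘ Adj-sym G))))
  where
  light : ∀ {p q} → p ≢ q → ¬ Adj G p q → ℓ p + ℓ q ≤ t
  light p≢q p≁q = subst (_≤ t) (weightSum-pair ℓ p≢q)
    (Equivalence.to (independent⇔ _) (Equivalence.from (Independent-pair⇔ G) p≁q))
  heavy : ∀ {p q} → Adj G p q → t < ℓ p + ℓ q
  heavy p~q = ≰⇒> λ ≤t → Equivalence.to (Independent-pair⇔ G)
    (Equivalence.from (independent⇔ _) (subst (_≤ t) (≡.sym (weightSum-pair ℓ (Adj⇒≢ G p~q))) ≤t)) p~q

module _ {R : Fin n → Fin n → Set}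
         (R-trans : ∀ {x y z} → R x y → R y z → R x z)
         (R-total : ∀ x y → R x y ⊎ R y x) where

  upperBound : ∀ {P : Fin n → Set} {m₀} → Decidable P → P m₀ →
               (L : List (Fin n)) → ∃[ m ] P m × All (λ y → P y → R y m) L
  upperBound P? Pm₀ [] = _ , Pm₀ , []
  upperBound P? Pm₀ (x ∷ L) with upperBound P? Pm₀ L | P? x
  ... | m , Pm , below | no ¬Px = m , Pm , (λ Px → contradiction Px ¬Px) ∷ below
  ... | m , Pm , below | yes Px with R-total x m
  ...   | inj₁ xRm = m , Pm , (λ _ → xRm) ∷ below
  ...   | inj₂ mRx =
    x , Px , (λ _ → Sum.reduce (R-total x x)) ∷ All.map (λ yRm Py → R-trans (yRm Py) mRx) below

  maximum : ∀ {P : Fin n → Set} {m₀} → Decidable P → P m₀ → ∃[ m ] P m × (∀ {y} → P y → R y m)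
  maximum P? Pm₀ with upperBound P? Pm₀ (allFin _)
  ... | m , Pm , below = m , Pm , λ {y} → All.lookup below (∈-allFin y)

_≼[_]_ : Fin n → Graph n → Fin n → Set
x ≼[ G ] y = ∀ {z} → z ≢ y → Adj G x z → Adj G y z

≼-trans : ∀ (G : Graph n) {x y z} → x ≼[ G ] y → y ≼[ G ] z → x ≼[ G ] z
≼-trans G {x} {y} {z} x≼y y≼z {w} w≢z x~w with w ≟ y
... | no w≢y = y≼z w≢z (x≼y w≢y x~w)
... | yes refl with x ≟ z
...   | yes refl = x~w
...   | no x≢z   = Adj-sym G (x≼y (w≢z ∘ ≡.sym) (Adj-sym G (y≼z x≢z (Adj-sym G x~w))))

≼-total : ∀ {G : Graph n} → AlternatingFree G → ∀ x y → x ≼[ G ] y ⊎ y ≼[ G ] x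
≼-total {G = G} free x y with any? (λ a → ¬? (a ≟ y) ×-dec adj? G x a ×-dec ¬? (adj? G y a))
... | yes (a , a≢y , x~a , y≁a) = inj₂ λ {b} b≢x y~b →
  decidable-stable (adj? G x b) λ x≁b → free (alternating (b≢x ∘ ≡.sym) (a≢y ∘ ≡.sym) x~a y~b x≁b y≁a)
... | no ∄a = inj₁ λ {z} z≢y x~z →
  decidable-stable (adj? G y z) λ y≁z → ∄a (z , z≢y , x~z , y≁z)

isolatedOrDominating : ∀ {G : Graph n} {S w₀} → AlternatingFree G → w₀ ∈ S →
                       ∃[ w ] w ∈ S × (Isolated G S w ⊎ Dominating G S w)
isolatedOrDominating {G = G} {S} free w₀∈S
  with maximum (≼-trans G) (≼-total free) (λ y → S y Bool.≟ true) w₀∈S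
... | m , m∈S , ≼m with any? (λ y → S y Bool.≟ true ×-dec ¬? (y ≟ m) ×-dec ¬? (adj? G m y))
...   | yes (y , y∈S , y≢m , m≁y) = y , y∈S , inj₁ isolated
  where
  isolated : Isolated G S y
  isolated {z} z∈S y~z with z ≟ m
  ... | yes refl = m≁y (Adj-sym G y~z)
  ... | no z≢m   = m≁y (≼m z∈S y≢m (Adj-sym G y~z))
...   | no ∄y = m , m∈S , inj₂ λ {z} z∈S z≢m →
  decidable-stable (adj? G m z) λ m≁z → ∄y (z , z∈S , z≢m , m≁z)

record ThresholdOn (G : Graph n) (S : VSubset n) : Set where
  field
    weight     : Fin n → ℕ
    bound      : ℕ
    weight-pos : ∀ i → 0 < weight i
    represents : ∀ {X} → X ⊆ S → Independent G X ⇔ weightSum weight X ≤ bound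

thresholdOn-empty : ∀ {G : Graph n} {S} → Empty S → ThresholdOn G S
thresholdOn-empty empty = record
  { weight     = const 1
  ; bound      = 0
  ; weight-pos = λ _ → s≤s z≤n
  ; represents = λ X⊆S → mk⇔
      (λ _ → ≤-reflexive (weightSum-empty λ i i∈X → empty i (X⊆S i∈X)))
      (λ _ x _ x∈X → contradiction (X⊆S x∈X) (empty x))
  }

doubled : (Fin n → ℕ) → Fin n → ℕ → Fin n → ℕ
doubled ℓ w a = updateAt (λ i → 2 * ℓ i) w (const a)

doubled-pos : ∀ {ℓ : Fin n → ℕ} {a} → (∀ i → 0 < ℓ i) → 0 < a → ∀ w i → 0 < doubled ℓ w a i
doubled-pos {ℓ = ℓ} ℓ-pos a-pos w i with i ≟ w
... | yes refl = subst (0 <_) (≡.sym (updateAt-updates i _)) a-pos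
... | no i≢w   = subst (0 <_) (≡.sym (updateAt-minimal i w _ i≢w)) (≤-trans (ℓ-pos i) (m≤m+n (ℓ i) _))

weightSum-doubled : ∀ (ℓ : Fin n → ℕ) X w a →
  weightSum (doubled ℓ w a) X ≡ 2 * weightSum ℓ (X ─ w) + (if X w then a else 0)
weightSum-doubled ℓ X w a = trans (weightSum-updateAt _ X w a) (cong (_+ _) (weightSum-* 2 ℓ (X ─ w)))

module _ {G : Graph n} {S : VSubset n} {w : Fin n} (r : ThresholdOn G (S ─ w)) where
  open ThresholdOn r

  represents-doubled : ∀ {a X} → X ⊆ S → (if X w then a else 0) ≤ 1 →
    Independent G X ⇔ Independent G (X ─ w) →
    Independent G X ⇔ weightSum (doubled weight w a) X ≤ suc (2 * bound)
  represents-doubled {a} {X} X⊆S wa≤1 ind⇔ rewrite weightSum-doubled weight X w a =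
    ⇔-sym (2*m+b≤1+2*n⇔m≤n _ bound wa≤1) ⇔-∘ (represents (─-mono X⊆S) ⇔-∘ ind⇔)

  extend-isolated : Isolated G S w → ThresholdOn G S
  extend-isolated isolated = record
    { weight     = doubled weight w 1
    ; bound      = suc (2 * bound)
    ; weight-pos = doubled-pos weight-pos (s≤s z≤n) w
    ; represents = λ {X} X⊆S → represents-doubled X⊆S (if≤1 (X w))
                                  (Independent⇔Independent-─ G λ _ z∈X → isolated (X⊆S z∈X))
    }
    where
    if≤1 : ∀ b → (if b then 1 else 0) ≤ 1
    if≤1 true  = ≤-refl
    if≤1 false = z≤n

  extend-dominating : Dominating G S w → ThresholdOn G S
  extend-dominating dominating = record
    { weight     = doubled weight w (suc (2 * bound))
    ; bound      = suc (2 * bound)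
    ; weight-pos = doubled-pos weight-pos (s≤s z≤n) w
    ; represents = represents′
    }
    where
    represents′ : ∀ {X} → X ⊆ S →
                  Independent G X ⇔ weightSum (doubled weight w (suc (2 * bound))) X ≤ suc (2 * bound)
    represents′ {X} X⊆S with X w in Xw≡
    ... | false = represents-doubled X⊆S (subst (λ b → (if b then _ else 0) ≤ 1) (≡.sym Xw≡) z≤n)
                    (Independent⇔Independent-─ G λ w∈X → contradiction (trans (≡.sym Xw≡) w∈X) λ ())
    ... | true rewrite weightSum-doubled weight X w (suc (2 * bound)) | Xw≡ =
      ⇔-sym (2*m+n≤n⇔m≡0 _ _) ⇔-∘ (⇔-sym (weightSum≡0⇔Empty weight-pos)
        ⇔-∘ Independent⇔Empty-─ G Xw≡ λ z∈X → dominating (X⊆S z∈X))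

alternatingFree⇒thresholdOn : ∀ {G : Graph n} → AlternatingFree G → ∀ k S → ∣ S ∣ ≡ k → ThresholdOn G S
alternatingFree⇒thresholdOn free zero S ∣S∣≡0 =
  thresholdOn-empty (Equivalence.to (weightSum≡0⇔Empty (λ _ → s≤s z≤n)) ∣S∣≡0)
alternatingFree⇒thresholdOn free (suc k) S ∣S∣≡1+k with nonempty? S
... | no ∄i = thresholdOn-empty λ i i∈S → ∄i (i , i∈S)
... | yes (_ , i∈S) with isolatedOrDominating free i∈S
...   | w , w∈S , isolated⊎dominating = [ extend-isolated rest , extend-dominating rest ] isolated⊎dominating
  where
  rest = alternatingFree⇒thresholdOn free k (S ─ w) (suc-injective (trans (≡.sym (∣─∣ S w∈S)) ∣S∣≡1+k))

threshold⇔alternatingFree : ∀ {G : Graph n} → Threshold G ⇔ AlternatingFree G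
threshold⇔alternatingFree = mk⇔ threshold⇒alternatingFree alternatingFree⇒threshold
  where
  alternatingFree⇒threshold : ∀ {G : Graph n} → AlternatingFree G → Threshold G
  alternatingFree⇒threshold free = weight , bound , λ _ → represents (λ _ → refl)
    where open ThresholdOn (alternatingFree⇒thresholdOn free _ (const true) refl)

SamePair : Fin n → Fin n → Fin n → Fin n → Set
SamePair u v x y = (x ≡ u × y ≡ v) ⊎ (x ≡ v × y ≡ u)

samePair? : ∀ (u v x y : Fin n) → Dec (SamePair u v x y)
samePair? u v x y = (x ≟ u ×-dec y ≟ v) ⊎-dec (x ≟ v ×-dec y ≟ u)

samePair≡does : ∀ (u v x y : Fin n) → samePair u v x y ≡ does (samePair? u v x y)
samePair≡does u v x y =
  cong₂ _∨_ (cong₂ _∧_ (isYes≗does (x ≟ u)) (isYes≗does (y ≟ v)))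
            (cong₂ _∧_ (isYes≗does (x ≟ v)) (isYes≗does (y ≟ u)))

samePair-endpoint : ∀ {u v p q x y : Fin n} → SamePair u v p q → SamePair u v x y → x ≡ p ⊎ x ≡ q
samePair-endpoint (inj₁ (refl , refl)) (inj₁ (refl , _)) = inj₁ refl
samePair-endpoint (inj₁ (refl , refl)) (inj₂ (refl , _)) = inj₂ refl
samePair-endpoint (inj₂ (refl , refl)) (inj₁ (refl , _)) = inj₂ refl
samePair-endpoint (inj₂ (refl , refl)) (inj₂ (refl , _)) = inj₁ refl

module _ (G : Graph n) where

  middleOfDiamond-sym : ∀ {u v} → MiddleOfDiamond G u v → MiddleOfDiamond G v u
  middleOfDiamond-sym (a , b , u≢v , u≢a , u≢b , v≢a , v≢b , a≢b , u~v , u~a , u~b , v~a , v~b , a≁b) =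
    a , b , u≢v ∘ ≡.sym , v≢a , v≢b , u≢a , u≢b , a≢b , Adj-sym G u~v , v~a , v~b , u~a , u~b , a≁b

  diamond⊎paw-samePair : ∀ {u v x y} → SamePair u v x y →
    MiddleOfDiamond G x y ⊎ SideOfPaw G x y → MiddleOfDiamond G u v ⊎ SideOfPaw G u v
  diamond⊎paw-samePair (inj₁ (refl , refl)) = id
  diamond⊎paw-samePair (inj₂ (refl , refl)) = Sum.map middleOfDiamond-sym Sum.swap

  middleOfPath⇒diamond⊎paw : ∀ {a x b y} → AlternatingFree G → a ≢ y →
    Adj G a x → Adj G x b → Adj G b y → ¬ Adj G a y → MiddleOfDiamond G x b ⊎ SideOfPaw G x b
  middleOfPath⇒diamond⊎paw {a} {x} {b} {y} free a≢y a~x x~b b~y a≁y =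
    classify (adj? G x y) (adj? G a b)
    where
    a≢x : a ≢ x
    a≢x = Adj⇒≢ G a~x
    x≢b : x ≢ b
    x≢b = Adj⇒≢ G x~b
    b≢y : b ≢ y
    b≢y = Adj⇒≢ G b~y
    x≢y : x ≢ y
    x≢y refl = a≁y a~x
    a≢b : a ≢ b
    a≢b refl = a≁y b~y
    classify : Dec (Adj G x y) → Dec (Adj G a b) → MiddleOfDiamond G x b ⊎ SideOfPaw G x b
    classify (yes x~y) (yes a~b) = inj₁
      (a , y , x≢b , a≢x ∘ ≡.sym , x≢y , a≢b ∘ ≡.sym , b≢y , a≢y ,
       x~b , Adj-sym G a~x , x~y , Adj-sym G a~b , b~y , a≁y)
    classify (yes x~y) (no a≁b) = inj₂ (inj₁
      (a , y , a≢x , a≢b , a≢y , x≢b , x≢y , b≢y ,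
       a~x , x~b , b~y , x~y , a≁b , a≁y))
    classify (no x≁y) (yes a~b) = inj₂ (inj₂
      (y , a , b≢y ∘ ≡.sym , x≢y ∘ ≡.sym , a≢y ∘ ≡.sym , x≢b ∘ ≡.sym , a≢b ∘ ≡.sym , a≢x ∘ ≡.sym ,
       Adj-sym G b~y , Adj-sym G x~b , Adj-sym G a~x , Adj-sym G a~b , x≁y ∘ Adj-sym G , a≁y ∘ Adj-sym G))
    classify (no x≁y) (no a≁b) =
      ⊥-elim (free (alternating a≢b (x≢y ∘ ≡.sym) a~x (Adj-sym G b~y) a≁b (x≁y ∘ Adj-sym G)))

  module _ (u v : Fin n) where

    deleteEdge-⊆ : ∀ {x y} → Adj (deleteEdge G u v) x y → Adj G x y
    deleteEdge-⊆ = ∧-conicalˡ _ _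

    deleteEdge-removes : ∀ {x y} → SamePair u v x y → ¬ Adj (deleteEdge G u v) x y
    deleteEdge-removes {x} {y} same x~y =
      contradiction (trans (cong not (≡.sym samePair≡true)) (∧-conicalʳ _ _ x~y)) λ ()
      where
      samePair≡true : samePair u v x y ≡ true
      samePair≡true = trans (samePair≡does u v x y) (dec-true (samePair? u v x y) same)

    deleteEdge-keeps : ∀ {x y} → Adj G x y → ¬ SamePair u v x y → Adj (deleteEdge G u v) x y
    deleteEdge-keeps {x} {y} x~y ¬same =
      cong₂ (λ a s → a ∧ not s) x~y (trans (samePair≡does u v x y) (dec-false (samePair? u v x y) ¬same))

    deleteEdge-deleted : ∀ {x y} → Adj G x y → ¬ Adj (deleteEdge G u v) x y → SamePair u v x y
    deleteEdge-deleted {x} {y} x~y x≁y = decidable-stable (samePair? u v x y) (x≁y ∘ deleteEdge-keeps x~y)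

    deleteEdge-keeps-outside : ∀ {p q x y} → SamePair u v p q → x ≢ p → x ≢ q → Adj G x y →
                               Adj (deleteEdge G u v) x y
    deleteEdge-keeps-outside same x≢p x≢q x~y =
      deleteEdge-keeps x~y λ same′ → [ x≢p , x≢q ] (samePair-endpoint same same′)

    alternating-deleteEdge⇒diamond⊎paw : ∀ {x a y b} → AlternatingFree G →
      Alternating (deleteEdge G u v) x a y b → MiddleOfDiamond G u v ⊎ SideOfPaw G u v
    alternating-deleteEdge⇒diamond⊎paw {x} {a} {y} {b} free
      (alternating x≢b y≢a x~a y~b x≁b y≁a) = classify (adj? G x b) (adj? G y a)
      where
      x~a∈G : Adj G x a
      x~a∈G = deleteEdge-⊆ x~a
      y~b∈G : Adj G y b
      y~b∈G = deleteEdge-⊆ y~b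
      xb-deleted : Adj G x b → SamePair u v x b
      xb-deleted x~b∈G = deleteEdge-deleted x~b∈G x≁b
      ya-deleted : Adj G y a → SamePair u v y a
      ya-deleted y~a∈G = deleteEdge-deleted y~a∈G y≁a
      classify : Dec (Adj G x b) → Dec (Adj G y a) → MiddleOfDiamond G u v ⊎ SideOfPaw G u v
      classify (no x≁b∈G) (no y≁a∈G) = ⊥-elim (free (alternating x≢b y≢a x~a∈G y~b∈G x≁b∈G y≁a∈G))
      classify (yes x~b∈G) (no y≁a∈G) = diamond⊎paw-samePair (xb-deleted x~b∈G)
        (middleOfPath⇒diamond⊎paw free (y≢a ∘ ≡.sym)
          (Adj-sym G x~a∈G) x~b∈G (Adj-sym G y~b∈G) (y≁a∈G ∘ Adj-sym G))
      classify (no x≁b∈G) (yes y~a∈G) = diamond⊎paw-samePair (ya-deleted y~a∈G)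
        (middleOfPath⇒diamond⊎paw free (x≢b ∘ ≡.sym)
          (Adj-sym G y~b∈G) y~a∈G (Adj-sym G x~a∈G) (x≁b∈G ∘ Adj-sym G))
      classify (yes x~b∈G) (yes y~a∈G) with samePair-endpoint (ya-deleted y~a∈G) (xb-deleted x~b∈G)
      ... | inj₁ refl = ⊥-elim (y≁a x~a)
      ... | inj₂ refl = ⊥-elim (Adj⇒≢ (deleteEdge G u v) x~a refl)

    middleOfPath⇒¬alternatingFree : ∀ {a p q d} → SamePair u v p q → p ≢ q → a ≢ d →
      Adj G a p → Adj G q d → ¬ Adj G a d → ¬ AlternatingFree (deleteEdge G u v)
    middleOfPath⇒¬alternatingFree {a} {p} {q} {d} pq p≢q a≢d a~p q~d a≁d free =
      free (alternating a≢d (p≢q ∘ ≡.sym)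
        (deleteEdge-keeps-outside pq (Adj⇒≢ G a~p) a≢q a~p)
        (Adj-sym (deleteEdge G u v) (deleteEdge-keeps-outside pq d≢p (Adj⇒≢ G q~d ∘ ≡.sym) (Adj-sym G q~d)))
        (a≁d ∘ deleteEdge-⊆)
        (deleteEdge-removes pq ∘ Adj-sym (deleteEdge G u v)))
      where
      a≢q : a ≢ q
      a≢q refl = a≁d q~d
      d≢p : d ≢ p
      d≢p refl = a≁d a~p

    middleOfDiamond⇒¬alternatingFree : MiddleOfDiamond G u v → ¬ AlternatingFree (deleteEdge G u v)
    middleOfDiamond⇒¬alternatingFree (a , b , u≢v , _ , _ , _ , _ , a≢b , _ , u~a , _ , _ , v~b , a≁b) =
      middleOfPath⇒¬alternatingFree (inj₁ (refl , refl)) u≢v a≢b (Adj-sym G u~a) v~b a≁b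

    sideOfPaw⇒¬alternatingFree : SideOfPaw G u v → ¬ AlternatingFree (deleteEdge G u v)
    sideOfPaw⇒¬alternatingFree (inj₁ (a , d , _ , _ , a≢d , u≢v , _ , _ , a~u , _ , v~d , _ , _ , a≁d)) =
      middleOfPath⇒¬alternatingFree (inj₁ (refl , refl)) u≢v a≢d a~u v~d a≁d
    sideOfPaw⇒¬alternatingFree (inj₂ (a , d , _ , _ , a≢d , v≢u , _ , _ , a~v , _ , u~d , _ , _ , a≁d)) =
      middleOfPath⇒¬alternatingFree (inj₂ (refl , refl)) v≢u a≢d a~v u~d a≁d

    alternatingFree-deleteEdge⇔ : AlternatingFree G →
      AlternatingFree (deleteEdge G u v) ⇔ (¬ MiddleOfDiamond G u v × ¬ SideOfPaw G u v)
    alternatingFree-deleteEdge⇔ free = mk⇔ unobstructed alternatingFree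
      where
      unobstructed : AlternatingFree (deleteEdge G u v) → ¬ MiddleOfDiamond G u v × ¬ SideOfPaw G u v
      unobstructed free′ = (λ diamond → middleOfDiamond⇒¬alternatingFree diamond free′)
                         , (λ paw → sideOfPaw⇒¬alternatingFree paw free′)
      alternatingFree : ¬ MiddleOfDiamond G u v × ¬ SideOfPaw G u v → AlternatingFree (deleteEdge G u v)
      alternatingFree (¬diamond , ¬paw) alt =
        [ ¬diamond , ¬paw ] (alternating-deleteEdge⇒diamond⊎paw free alt)

lemma4p3 : (n : ℕ) (G : Graph n) → Threshold G →
    (u v : Fin n) → Adj G u v →
    (Threshold (deleteEdge G u v) ⇔ (¬ MiddleOfDiamond G u v × ¬ SideOfPaw G u v))
lemma4p3 n G thG u v _ =
  alternatingFree-deleteEdge⇔ G u v (threshold⇒alternatingFree thG) ⇔-∘ threshold⇔alternatingFree
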